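{- For $n\in\{3,4,5\}$, the prism $Y_n=C_n\square P_2$ satisfies $IDI(Y_n)=3$.
   Context: $C_n$ is the cycle on $n$ vertices, $P_2$ the path on two vertices, $\square$ the Cartesian product. For a connected graph $G=(V,E)$ of diameter $d$ and $f:V\to\mathbb{R}$, the string of $v$ under $f$ is the $d$-vector whose $i$-th coordinate is $\sum_{w:\ d(v,w)=i} f(w)$ ($d(\cdot,\cdot)$ = graph distance). $IDI(G)$ is the minimum $k$ such that some $f$ with $|f(V)|=k$ gives all vertices pairwise distinct strings.
   Formalization: The function $f$ in the definition of $IDI(G)$ takes rational values rather than real ones. -}

module Defs where

open import Data.Bool using (Bool; true; false; _∧_; _∨_; not; if_then_else_)
open import Data.Nat as ℕ using (ℕ; zero; suc; _≡ᵇ_; _∸_; _≤_)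
open import Data.Fin using (Fin; toℕ; remQuot)
open import Data.Fin.Properties using () renaming (_≟_ to _≟F_)
open import Data.List using (List; []; _∷_; allFin; foldr; map; length; deduplicate)
open import Data.Bool.ListAction using (any; all)
open import Data.Product using (Σ; _×_; proj₁; proj₂; ∃)
open import Data.Rational as ℚ using (ℚ; 0ℚ)
open import Data.Rational.Properties using () renaming (_≟_ to _≟ℚ_)
open import Relation.Nullary using (¬_; ⌊_⌋)
open import Relation.Binary.PropositionalEquality using (_≡_; _≢_)

-- A finite graph on the vertex set Fin N, given by a Boolean adjacency
-- relation. (Only used for the concrete simple graphs defined below,
-- whose adjacency is symmetric and irreflexive by construction.)
record Graph : Set where
  field
    N     : ℕ
    adj   : Fin N → Fin N → Bool
open Graph public

module _ (G : Graph) where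
  private
    V = Fin (N G)
    vs = allFin (N G)

  within : ℕ → V → V → Bool
  within zero    v w = ⌊ v ≟F w ⌋
  within (suc i) v w = within i v w ∨ any (λ u → within i v u ∧ adj G u w) vs

  distIs : ℕ → V → V → Bool
  distIs zero    v w = within zero v w
  distIs (suc i) v w = within (suc i) v w ∧ not (within i v w)

  allWithin : ℕ → Bool
  allWithin i = all (λ v → all (λ w → within i v w) vs) vs

  -- diameter: least i ≤ N with all pairs at distance ≤ i
  -- (for a connected graph every distance is < N, so this is the diameter)
  diamFrom : ℕ → ℕ → ℕ
  diamFrom i zero    = i
  diamFrom i (suc k) = if allWithin i then i else diamFrom (suc i) k

  diameter : ℕ
  diameter = diamFrom 0 (N G)

  distSum : (V → ℚ) → V → ℕ → ℚ
  distSum f v i = foldr ℚ._+_ 0ℚ (map (λ w → if distIs i v w then f w else 0ℚ) vs)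

  stringFrom : (V → ℚ) → V → ℕ → ℕ → List ℚ
  stringFrom f v i zero    = []
  stringFrom f v i (suc k) = distSum f v i ∷ stringFrom f v (suc i) k

  string : (V → ℚ) → V → List ℚ
  string f v = stringFrom f v 1 diameter

  imageSize : (V → ℚ) → ℕ
  imageSize f = length (deduplicate _≟ℚ_ (map f vs))

  Distinguishing : (V → ℚ) → Set
  Distinguishing f = ∀ u v → u ≢ v → string f u ≢ string f v

  IDIis : ℕ → Set
  IDIis k = (Σ (V → ℚ) λ f → Distinguishing f × imageSize f ≡ k)
          × (∀ f → Distinguishing f → k ≤ imageSize f)

-- Cartesian product G □ H on Fin (N G * N H), vertex (a,b) encoded by combine
_□_ : Graph → Graph → Graph
G □ H = record { N = N G ℕ.* N H ; adj = a }
  where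
  a : Fin (N G ℕ.* N H) → Fin (N G ℕ.* N H) → Bool
  a x y with remQuot (N H) x | remQuot (N H) y
  ... | (g₁ Data.Product., h₁) | (g₂ Data.Product., h₂) =
    (⌊ g₁ ≟F g₂ ⌋ ∧ adj H h₁ h₂) ∨ (adj G g₁ g₂ ∧ ⌊ h₁ ≟F h₂ ⌋)

-- the cycle C_n on Fin n (intended for n ≥ 3): i ~ i+1 mod n
cycleAdj : (n : ℕ) → Fin n → Fin n → Bool
cycleAdj n i j = step (toℕ i) (toℕ j) ∨ step (toℕ j) (toℕ i)
  where
  step : ℕ → ℕ → Bool
  step x y = (suc x ≡ᵇ y) ∨ ((x ≡ᵇ n ∸ 1) ∧ (y ≡ᵇ 0))

C : ℕ → Graph
C n = record { N = n ; adj = cycleAdj n }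

P₂ : Graph
P₂ = record { N = 2 ; adj = λ i j → not ⌊ i ≟F j ⌋ }

Y : ℕ → Graph
Y n = C n □ P₂

{-# OPTIONS --safe #-}
-- Upper bound: an explicit labelling with three values separates all vertices.
-- Lower bound: a labelling with at most two values a, b is "b on a vertex set p, a elsewhere",
-- so the i-th coordinate of the string of v is m · a + k · b, where m and k count the
-- vertices outside and inside p at distance i from v.  Hence it suffices that for each of
-- the 2^(2n) sets p two distinct vertices have the same counts on every layer.  Both facts
-- are checked exhaustively, using the closed-form prism distance
-- min(|i - i′|, n - |i - i′|) + |h - h′|, itself checked against the graph distance.
module Submission where

open import Defs
open import Data.Nat using (ℕ; zero; suc; _≡ᵇ_; _∸_; _⊓_; ∣_-_∣; _≤_; s≤s)
open import Data.Sum using (_⊎_; inj₁; inj₂)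
open import Relation.Binary.PropositionalEquality
  using (_≡_; _≢_; _≗_; refl; sym; trans; cong; cong₂; module ≡-Reasoning)

open import Algebra.Bundles using (CommutativeMonoid)
open import Data.Bool using (Bool; true; false; _∧_; not; if_then_else_)
import Data.Bool.Properties as Bool
open import Data.Fin using (Fin; toℕ; remQuot)
open import Data.Fin.Properties using (all?; any?) renaming (_≟_ to _≟F_)
open import Data.Fin.Subset using (Subset)
open import Data.Fin.Subset.Properties using (anySubset?)
import Data.Integer as ℤ
open import Data.List
  using (List; []; _∷_; allFin; foldr; map; length; filterᵇ; tabulate; deduplicate)
open import Data.List.Membership.Propositional using (_∈_)
open import Data.List.Membership.Propositional.Properties
  using (∈-allFin; ∈-deduplicate⁺; ∈-map⁺)
open import Data.List.Relation.Unary.Any using (here; there)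
import Data.List.Properties as List
import Data.Nat as ℕ using (_+_)
open import Data.Nat.DivMod using (_/_; _%_)
open import Data.Nat.Properties using (+-suc; +-comm; ≤-pred; ≮⇒≥) renaming (_≟_ to _≟ℕ_)
open import Data.Product using (Σ; ∃₂; _×_; _,_; proj₁; proj₂)
import Data.Product.Properties as Product
open import Data.Rational as ℚ using (ℚ; 0ℚ; _+_)
import Data.Rational.Properties as ℚ
open import Data.Vec using (Vec; lookup; []; _∷_) renaming (tabulate to tabulateᵛ)
import Data.Vec.Properties as Vec
open import Function using (_∘_)
open import Relation.Binary.Definitions using (DecidableEquality)
open import Relation.Nullary using (Dec; does; yes; no; ¬_; ¬?; contradiction; _×-dec_)
open import Relation.Nullary.Decidable using (True; toWitness; map′; decidable-stable)
open import Relation.Unary using (Pred; Decidable)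

open import Algebra.Definitions.RawMonoid ℚ.+-0-rawMonoid renaming (_×_ to _·_)
open import Algebra.Properties.CommutativeSemigroup
  (CommutativeMonoid.commutativeSemigroup ℚ.+-0-commutativeMonoid) using (x∙yz≈y∙xz)

allSubset? : ∀ {n ℓ} {P : Pred (Subset n) ℓ} → Decidable P → Dec (∀ p → P p)
allSubset? P? = map′ (λ ¬∃¬ p → decidable-stable (P? p) (λ ¬Pp → ¬∃¬ (p , ¬Pp)))
                     (λ ∀P (p , ¬Pp) → ¬Pp (∀P p))
                     (¬? (anySubset? (¬? ∘ P?)))

NonInjective : ∀ {A : Set} {n} → (Fin n → A) → Set
NonInjective f = ∃₂ λ u v → u ≢ v × f u ≡ f v

NonInjective-cong : ∀ {A : Set} {n} {f g : Fin n → A} → f ≗ g → NonInjective f → NonInjective g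
NonInjective-cong f≗g (u , v , u≢v , fu≡fv) =
  u , v , u≢v , trans (sym (f≗g u)) (trans fu≡fv (f≗g v))

-- Searching the tabulated values rather than f itself makes each f u be evaluated only once.
nonInjective? : ∀ {A : Set} {n} → DecidableEquality A → (f : Fin n → A) → Dec (NonInjective f)
nonInjective? _≟_ f = map′ (NonInjective-cong (Vec.lookup∘tabulate f))
                           (NonInjective-cong (sym ∘ Vec.lookup∘tabulate f))
                           (search (tabulateᵛ f))
  where
  search : ∀ {n} (t : Vec _ n) → Dec (NonInjective (lookup t))
  search t = any? λ u → any? λ v → ¬? (u ≟F v) ×-dec (lookup t u ≟ lookup t v)

module _ {A : Set} where

  sumWhere : (A → Bool) → (A → ℚ) → List A → ℚ
  sumWhere P f xs = foldr _+_ 0ℚ (map (λ x → if P x then f x else 0ℚ) xs)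

  countWhere : (A → Bool) → List A → ℕ
  countWhere P xs = length (filterᵇ P xs)

  sumWhere-cong : ∀ {P Q : A → Bool} {f g : A → ℚ} → P ≗ Q → f ≗ g → ∀ xs →
                  sumWhere P f xs ≡ sumWhere Q g xs
  sumWhere-cong P≗Q f≗g xs = cong (foldr _+_ 0ℚ)
    (List.map-cong (λ x → cong₂ (λ b q → if b then q else 0ℚ) (P≗Q x) (f≗g x)) xs)

  select : (A → Bool) → ℚ → ℚ → A → ℚ
  select s a b x = if s x then b else a

  sumWhere-select : ∀ (P s : A → Bool) a b xs →
                    sumWhere P (select s a b) xs
                    ≡ countWhere (λ x → P x ∧ not (s x)) xs · a
                      + countWhere (λ x → P x ∧ s x) xs · b
  sumWhere-select P s a b [] = refl
  sumWhere-select P s a b (x ∷ xs) with P x | s x | sumWhere-select P s a b xs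
  ... | false | _     | ih = trans (ℚ.+-identityˡ _) ih
  ... | true  | false | ih = trans (cong (a +_) ih) (sym (ℚ.+-assoc a _ _))
  ... | true  | true  | ih = trans (cong (b +_) ih)
                                   (x∙yz≈y∙xz b (countWhere (λ x → P x ∧ not (s x)) xs · a)
                                                (countWhere (λ x → P x ∧ s x) xs · b))

length≤2⇒twoValued : ∀ (xs : List ℚ) → length xs ≤ 2 →
                     ∃₂ λ a b → ∀ {x} → x ∈ xs → x ≡ a ⊎ x ≡ b
length≤2⇒twoValued []              _ = 0ℚ , 0ℚ , λ ()
length≤2⇒twoValued (x ∷ [])        _ = x , x , λ { (here refl) → inj₁ refl }
length≤2⇒twoValued (x ∷ y ∷ [])    _ =
  x , y , λ { (here refl) → inj₁ refl ; (there (here refl)) → inj₂ refl }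
length≤2⇒twoValued (_ ∷ _ ∷ _ ∷ _) (s≤s (s≤s ()))

module _ (G : Graph) where
  private
    V = Fin (N G)
    vs = allFin (N G)

  stringFrom-tabulate : ∀ f v i k →
                        stringFrom G f v i k ≡ tabulate (λ (j : Fin k) → distSum G f v (toℕ j ℕ.+ i))
  stringFrom-tabulate f v i zero    = refl
  stringFrom-tabulate f v i (suc k) = cong (distSum G f v i ∷_) (begin
    stringFrom G f v (suc i) k                           ≡⟨ stringFrom-tabulate f v (suc i) k ⟩
    tabulate (λ j → distSum G f v (toℕ j ℕ.+ suc i))     ≡⟨ List.tabulate-cong shift ⟩
    tabulate (λ j → distSum G f v (suc (toℕ j ℕ.+ i)))   ∎)
    where
    open ≡-Reasoning
    shift : ∀ (j : Fin k) → distSum G f v (toℕ j ℕ.+ suc i) ≡ distSum G f v (suc (toℕ j ℕ.+ i))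
    shift j = cong (distSum G f v) (+-suc (toℕ j) i)

  imageSize≤2⇒select : ∀ f → imageSize G f ≤ 2 →
                       Σ (Subset (N G)) λ p → ∃₂ λ a b → f ≗ select (lookup p) a b
  imageSize≤2⇒select f size≤2 = p , a , b , f≗select
    where
    a-or-b = length≤2⇒twoValued (deduplicate ℚ._≟_ (map f vs)) size≤2
    a = proj₁ a-or-b
    b = proj₁ (proj₂ a-or-b)
    value : ∀ w → f w ≡ a ⊎ f w ≡ b
    value w = proj₂ (proj₂ a-or-b) (∈-deduplicate⁺ ℚ._≟_ (∈-map⁺ f (∈-allFin w)))
    isB : V → Bool
    isB w = does (f w ℚ.≟ b)
    p = tabulateᵛ isB
    f≗select : f ≗ select (lookup p) a b
    f≗select w rewrite Vec.lookup∘tabulate isB w with f w ℚ.≟ b | value w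
    ... | yes fw≡b | _         = fw≡b
    ... | no  _    | inj₁ fw≡a = fw≡a
    ... | no  fw≢b | inj₂ fw≡b = contradiction fw≡b fw≢b

  module _ (dist : V → V → ℕ) (d : ℕ) where

    AgreesWithDistIs : Set
    AgreesWithDistIs =
      ∀ (j : Fin d) v w → distIs G (suc (toℕ j)) v w ≡ (dist v w ≡ᵇ suc (toℕ j))

    layerSum : (V → ℚ) → V → ℕ → ℚ
    layerSum f v i = sumWhere (λ w → dist v w ≡ᵇ i) f vs

    layerString : (V → ℚ) → V → List ℚ
    layerString f v = tabulate (λ (j : Fin d) → layerSum f v (suc (toℕ j)))

    layerCounts : Subset (N G) → V → ℕ → ℕ × ℕ
    layerCounts p v i = countWhere (λ w → (dist v w ≡ᵇ i) ∧ not (lookup p w)) vs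
                      , countWhere (λ w → (dist v w ≡ᵇ i) ∧ lookup p w) vs

    profile : Subset (N G) → V → List (ℕ × ℕ)
    profile p v = tabulate (λ (j : Fin d) → layerCounts p v (suc (toℕ j)))

    Separating : (V → ℚ) → Set
    Separating f = ¬ NonInjective (layerString f)

    TwoValuedNeverSeparates : Set
    TwoValuedNeverSeparates = ∀ p → NonInjective (profile p)

    agreesWithDistIs? : Dec AgreesWithDistIs
    agreesWithDistIs? = all? λ j → all? λ v → all? λ w →
      distIs G (suc (toℕ j)) v w Bool.≟ (dist v w ≡ᵇ suc (toℕ j))

    separating? : ∀ f → Dec (Separating f)
    separating? f = ¬? (nonInjective? (List.≡-dec ℚ._≟_) (layerString f))

    twoValuedNeverSeparates? : Dec TwoValuedNeverSeparates
    twoValuedNeverSeparates? =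
      allSubset? (nonInjective? (List.≡-dec (Product.≡-dec _≟ℕ_ _≟ℕ_)) ∘ profile)

    string≡layerString : diameter G ≡ d → AgreesWithDistIs → ∀ f v → string G f v ≡ layerString f v
    string≡layerString diameter≡d agrees f v = begin
      stringFrom G f v 1 (diameter G)               ≡⟨ cong (stringFrom G f v 1) diameter≡d ⟩
      stringFrom G f v 1 d                          ≡⟨ stringFrom-tabulate f v 1 d ⟩
      tabulate (λ j → distSum G f v (toℕ j ℕ.+ 1))  ≡⟨ List.tabulate-cong layer ⟩
      layerString f v                               ∎
      where
      open ≡-Reasoning
      layer : ∀ (j : Fin d) → distSum G f v (toℕ j ℕ.+ 1) ≡ layerSum f v (suc (toℕ j))
      layer j rewrite +-comm (toℕ j) 1 = sumWhere-cong (agrees j v) (λ _ → refl) vs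

    layerString-cong : ∀ {f g} → f ≗ g → ∀ v → layerString f v ≡ layerString g v
    layerString-cong f≗g v = List.tabulate-cong (λ j → sumWhere-cong (λ _ → refl) f≗g vs)

    layerString-select : ∀ p a b v → layerString (select (lookup p) a b) v
                                     ≡ map (λ (m , k) → m · a + k · b) (profile p v)
    layerString-select p a b v = begin
      layerString (select (lookup p) a b) v                  ≡⟨ List.tabulate-cong layer ⟩
      tabulate (λ j → let (m , k) = layerCounts p v (suc (toℕ j)) in m · a + k · b)
                                                             ≡⟨ List.map-tabulate _ _ ⟨
      map (λ (m , k) → m · a + k · b) (profile p v)          ∎
      where
      open ≡-Reasoning
      layer : ∀ (j : Fin d) → layerSum (select (lookup p) a b) v (suc (toℕ j))
                              ≡ let (m , k) = layerCounts p v (suc (toℕ j)) in m · a + k · b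
      layer j = sumWhere-select (λ w → dist v w ≡ᵇ suc (toℕ j)) (lookup p) a b vs

    module _ (diameter≡d : diameter G ≡ d) (agrees : AgreesWithDistIs) where

      separating⇒distinguishing : ∀ f → Separating f → Distinguishing G f
      separating⇒distinguishing f separating u v u≢v same = separating (u , v , u≢v , (begin
        layerString f u  ≡⟨ string≡layerString diameter≡d agrees f u ⟨
        string G f u     ≡⟨ same ⟩
        string G f v     ≡⟨ string≡layerString diameter≡d agrees f v ⟩
        layerString f v  ∎))
        where open ≡-Reasoning

      imageSize≤2⇒¬distinguishing : TwoValuedNeverSeparates →
                                    ∀ f → imageSize G f ≤ 2 → ¬ Distinguishing G f
      imageSize≤2⇒¬distinguishing neverSeparates f size≤2 distinguishing =
        let (p , a , b , f≗select) = imageSize≤2⇒select f size≤2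
            (u , v , u≢v , sameProfile) = neverSeparates p
            combine = map (λ (m , k) → m · a + k · b)
            string≡profile : ∀ w → string G f w ≡ combine (profile p w)
            string≡profile w = trans (string≡layerString diameter≡d agrees f w)
                                     (trans (layerString-cong f≗select w)
                                            (layerString-select p a b w))
        in distinguishing u v u≢v (trans (string≡profile u)
                                   (trans (cong combine sameProfile) (sym (string≡profile v))))

      IDIis-3 : ∀ f → imageSize G f ≡ 3 → Separating f → TwoValuedNeverSeparates → IDIis G 3
      IDIis-3 f size≡3 separating neverSeparates =
        (f , separating⇒distinguishing f separating , size≡3) ,
        λ g distinguishing → ≮⇒≥ λ size<3 →
          imageSize≤2⇒¬distinguishing neverSeparates g (≤-pred size<3) distinguishing

cycleDist : ℕ → ℕ → ℕ → ℕ
cycleDist n i j = ∣ i - j ∣ ⊓ (n ∸ ∣ i - j ∣)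

-- Defs numbers the vertex (i , h) of C n □ P₂ as 2 i + h.
prismDist : ∀ n → Fin (N (Y n)) → Fin (N (Y n)) → ℕ
prismDist n x y = cycleDist n (toℕ x / 2) (toℕ y / 2) ℕ.+ ∣ toℕ x % 2 - toℕ y % 2 ∣

prismLabelling : ∀ {n} → Vec (Vec ℕ 2) n → Fin (N (Y n)) → ℚ
prismLabelling {n} rows x with remQuot {n} 2 x
... | i , h = ℤ.+ lookup (lookup rows i) h ℚ./ 1

prism-IDIis-3 : ∀ n d (rows : Vec (Vec ℕ 2) n) → let f = prismLabelling rows in
                diameter (Y n) ≡ d →
                True (agreesWithDistIs? (Y n) (prismDist n) d) →
                imageSize (Y n) f ≡ 3 →
                True (separating? (Y n) (prismDist n) d f) →
                True (twoValuedNeverSeparates? (Y n) (prismDist n) d) →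
                IDIis (Y n) 3
prism-IDIis-3 n d rows diameter≡d agrees size≡3 separating neverSeparates =
  IDIis-3 (Y n) (prismDist n) d diameter≡d (toWitness agrees)
          (prismLabelling rows) size≡3 (toWitness separating) (toWitness neverSeparates)

mainTheorem8 : (n : ℕ) → n ≡ 3 ⊎ n ≡ 4 ⊎ n ≡ 5 → IDIis (Y n) 3
mainTheorem8 .3 (inj₁ refl) =
  prism-IDIis-3 3 2 ((0 ∷ 0 ∷ []) ∷ (0 ∷ 1 ∷ []) ∷ (0 ∷ 2 ∷ []) ∷ [])
                refl _ refl _ _
mainTheorem8 .4 (inj₂ (inj₁ refl)) =
  prism-IDIis-3 4 3 ((0 ∷ 0 ∷ []) ∷ (0 ∷ 0 ∷ []) ∷ (0 ∷ 1 ∷ []) ∷ (2 ∷ 1 ∷ []) ∷ [])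
                refl _ refl _ _
mainTheorem8 .5 (inj₂ (inj₂ refl)) =
  prism-IDIis-3 5 3 ((0 ∷ 0 ∷ []) ∷ (0 ∷ 0 ∷ []) ∷ (0 ∷ 0 ∷ []) ∷ (0 ∷ 2 ∷ []) ∷ (1 ∷ 2 ∷ []) ∷ [])
                refl _ refl _ _
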